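{- Let $G$ be a $K_4$-free disk graph, let $\mathsf{opt}\ge 1$ be the minimum size of an odd cycle transversal of $G$, and let $\mathcal{T}$ be any maximal packing of triangles of $G$ (a maximal family of pairwise vertex-disjoint triangles), with $V(\mathcal{T})$ the union of its triangles and $a = |\mathcal{T}|/\mathsf{opt}$. Let $\rho_0\ge 1$, and let $X_1$ be an odd cycle transversal of the (planar) graph $G - V(\mathcal{T})$ of size at most $\rho_0$ times the minimum size of an odd cycle transversal of $G - V(\mathcal{T})$. Let $S_1 = V(\mathcal{T}) \cup X_1$. Then $|S_1| \leq (3a + \rho_0(1-a))\cdot \mathsf{opt}$.
   Context: A disk graph is the intersection graph of a finite set of closed disks in $\mathbb{R}^2$. An odd cycle transversal (OCT) of a graph $H$ is a set $X\subseteq V(H)$ with $H-X$ bipartite. A triangle is a set of three pairwise adjacent vertices. ($G-V(\mathcal{T})$ is triangle-free by maximality, and triangle-free disk graphs are planar; $X_1$ is thought of as the output of a $\rho_0$-approximation algorithm for Bipartization on planar graphs.)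
   Formalization: The disks have rational centres and radii rather than arbitrary centres in $\mathbb{R}^2$, and the parameter $\rho_0$ is rational. -}

module Defs where

open import Data.Nat as ℕ using (ℕ; _≤_; _>_)
open import Data.Fin using (Fin)
open import Data.Fin.Subset using (Subset; _∈_; _∉_; _⊆_; _∪_; ⁅_⁆; ⋃; ∣_∣; ⊤)
open import Data.Bool using (Bool)
open import Data.List using (List; tabulate)
open import Data.Integer using (+_)
open import Data.Rational as ℚ using (ℚ; 0ℚ; _+_; _-_; _*_)
open import Data.Product using (Σ; ∃; _×_; _,_)
open import Relation.Binary.PropositionalEquality using (_≡_; _≢_)
open import Relation.Nullary using (¬_)

record Disk : Set where
  constructor disk
  field
    cx cy r : ℚ

open Disk public

sq : ℚ → ℚ
sq x = x * x

-- two closed disks intersect iff the distance of the centres is at most r₁ + r₂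
Intersect : Disk → Disk → Set
Intersect D E = sq (cx D - cx E) + sq (cy D - cy E) ℚ.≤ sq (r D + r E)

ValidDisks : {n : ℕ} → (Fin n → Disk) → Set
ValidDisks {n} D = (i : Fin n) → 0ℚ ℚ.≤ r (D i)

Adj : {n : ℕ} → (Fin n → Disk) → Fin n → Fin n → Set
Adj D i j = i ≢ j × Intersect (D i) (D j)

K4Free : {n : ℕ} → (Fin n → Disk) → Set
K4Free D = ∀ a b c d → Adj D a b → Adj D a c → Adj D a d →
           Adj D b c → Adj D b d → Adj D c d → Data.Empty.⊥
  where import Data.Empty

record Triangle (n : ℕ) : Set where
  constructor tri
  field
    t₁ t₂ t₃ : Fin n

open Triangle public

IsTriangle : {n : ℕ} → (Fin n → Disk) → Triangle n → Set
IsTriangle D T = Adj D (t₁ T) (t₂ T) × Adj D (t₁ T) (t₃ T) × Adj D (t₂ T) (t₃ T)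

verts : {n : ℕ} → Triangle n → Subset n
verts T = ⁅ t₁ T ⁆ ∪ (⁅ t₂ T ⁆ ∪ ⁅ t₃ T ⁆)

Meet : {n : ℕ} → Triangle n → Triangle n → Set
Meet T U = ∃ λ v → v ∈ verts T × v ∈ verts U

IsMaximalTrianglePacking : {n t : ℕ} → (Fin n → Disk) → (Fin t → Triangle n) → Set
IsMaximalTrianglePacking {n} {t} D 𝒯 =
  ((k : Fin t) → IsTriangle D (𝒯 k)) ×
  ((k l : Fin t) → k ≢ l → ¬ Meet (𝒯 k) (𝒯 l)) ×
  ((T : Triangle n) → IsTriangle D T → ∃ λ k → Meet T (𝒯 k))

packingVertices : {n t : ℕ} → (Fin t → Triangle n) → Subset n
packingVertices {t = t} 𝒯 = ⋃ (tabulate {n = t} (λ k → verts (𝒯 k)))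

compl : {n : ℕ} → Subset n → Subset n
compl = Data.Fin.Subset.∁
  where import Data.Fin.Subset

-- X is an odd cycle transversal of the induced subgraph G[U]:
-- X ⊆ U and G[U] − X is bipartite (has a proper 2-colouring)
IsOCTIn : {n : ℕ} → (Fin n → Disk) → Subset n → Subset n → Set
IsOCTIn {n} D U X =
  X ⊆ U ×
  Σ (Fin n → Bool) (λ c → (i j : Fin n) → i ∈ U → j ∈ U → i ∉ X → j ∉ X →
                          Adj D i j → c i ≢ c j)

IsMinOCTSizeIn : {n : ℕ} → (Fin n → Disk) → Subset n → ℕ → Set
IsMinOCTSizeIn {n} D U m =
  (Σ (Subset n) λ X → IsOCTIn D U X × ∣ X ∣ ≡ m) ×
  ((X : Subset n) → IsOCTIn D U X → m ≤ ∣ X ∣)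

toℚ : ℕ → ℚ
toℚ k = (+ k) ℚ./ 1

ratio : (t opt : ℕ) → opt > 0 → ℚ
ratio t opt h = ((+ t) ℚ./ opt) {{ℕ.>-nonZero h}}

{-# OPTIONS --safe #-}
-- An optimal odd cycle transversal X of G meets every triangle, and the triangles of
-- 𝒯 are pairwise vertex-disjoint, so X has at least |𝒯| vertices in V(𝒯); the rest of X
-- is an odd cycle transversal of G − V(𝒯), hence |𝒯| + m ≤ opt. Therefore
-- |S₁| ≤ 3|𝒯| + ρ₀ m ≤ 3|𝒯| + ρ₀ (opt − |𝒯|) = (3a + ρ₀(1 − a)) opt.
module Submission where

open import Defs
open import Data.Bool using (Bool; true; false)
open import Data.Empty using (⊥; ⊥-elim)
open import Data.Fin using (Fin; zero; suc)
open import Data.Fin.Subset using (Subset; _∈_; _∉_; _⊆_; _∪_; _∩_; _─_; ∁; ⁅_⁆; ⋃; ∣_∣; ⊤; inside; outside)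
open import Data.Fin.Subset.Properties
open import Data.Integer as ℤ using (+_)
import Data.Integer.Properties as ℤ
open import Data.List using (tabulate)
open import Function using (_∘′_)
open import Data.Nat as ℕ using (ℕ; zero; suc; _≥_; z≤n; s≤s)
import Data.Nat.Properties as ℕ
open import Data.Nat.Coprimality as Coprime using (1-coprimeTo)
open import Data.Product using (∃; _×_; _,_; proj₂)
open import Data.Rational as ℚ using (ℚ; mkℚ; 0ℚ; 1ℚ; _≤_; _+_; _-_; _*_; toℚᵘ)
open import Data.Rational.Properties as ℚ using (toℚᵘ-fromℚᵘ)
import Data.Rational.Unnormalised as ℚᵘ
import Data.Rational.Unnormalised.Properties as ℚᵘ
open import Data.Rational.Solver using (module +-*-Solver)
open import Data.Sum using (inj₁; inj₂)
open import Data.Vec using (_∷_; [])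
open import Relation.Binary.PropositionalEquality
open import Relation.Nullary using (¬_; yes; no)

∣p∪q∣≤∣p∣+∣q∣ : ∀ {n} (p q : Subset n) → ∣ p ∪ q ∣ ℕ.≤ ∣ p ∣ ℕ.+ ∣ q ∣
∣p∪q∣≤∣p∣+∣q∣ []            []            = z≤n
∣p∪q∣≤∣p∣+∣q∣ (inside  ∷ p) (inside  ∷ q) = s≤s (ℕ.≤-trans (∣p∪q∣≤∣p∣+∣q∣ p q) (ℕ.+-monoʳ-≤ ∣ p ∣ (ℕ.n≤1+n ∣ q ∣)))
∣p∪q∣≤∣p∣+∣q∣ (inside  ∷ p) (outside ∷ q) = s≤s (∣p∪q∣≤∣p∣+∣q∣ p q)
∣p∪q∣≤∣p∣+∣q∣ (outside ∷ p) (inside  ∷ q) = subst (∣ p ∪ q ∣ ℕ.<_) (sym (ℕ.+-suc ∣ p ∣ ∣ q ∣)) (s≤s (∣p∪q∣≤∣p∣+∣q∣ p q))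
∣p∪q∣≤∣p∣+∣q∣ (outside ∷ p) (outside ∷ q) = ∣p∪q∣≤∣p∣+∣q∣ p q

∣p∣≡∣p∩q∣+∣p∩∁q∣ : ∀ {n} (p q : Subset n) → ∣ p ∣ ≡ ∣ p ∩ q ∣ ℕ.+ ∣ p ∩ ∁ q ∣
∣p∣≡∣p∩q∣+∣p∩∁q∣ []            []            = refl
∣p∣≡∣p∩q∣+∣p∩∁q∣ (inside  ∷ p) (inside  ∷ q) = cong suc (∣p∣≡∣p∩q∣+∣p∩∁q∣ p q)
∣p∣≡∣p∩q∣+∣p∩∁q∣ (inside  ∷ p) (outside ∷ q) = trans (cong suc (∣p∣≡∣p∩q∣+∣p∩∁q∣ p q)) (sym (ℕ.+-suc _ _))
∣p∣≡∣p∩q∣+∣p∩∁q∣ (outside ∷ p) (inside  ∷ q) = ∣p∣≡∣p∩q∣+∣p∩∁q∣ p q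
∣p∣≡∣p∩q∣+∣p∩∁q∣ (outside ∷ p) (outside ∷ q) = ∣p∣≡∣p∩q∣+∣p∩∁q∣ p q

Meets : ∀ {n} → Subset n → Subset n → Set
Meets p q = ∃ λ v → v ∈ p × v ∈ q

-- Deleting from Y a vertex v of A zero loses one element, and Y − v still meets every
-- other A k because A k avoids v.
hitting-set-size : ∀ {n t} (A : Fin t → Subset n) (Y : Subset n) →
                   (∀ k l → k ≢ l → ¬ Meets (A k) (A l)) →
                   (∀ k → Meets Y (A k)) → t ℕ.≤ ∣ Y ∣
hitting-set-size {t = zero}  A Y disjoint hits = z≤n
hitting-set-size {t = suc t} A Y disjoint hits with hits zero
... | v , v∈Y , v∈A₀ =
  ℕ.≤-<-trans (hitting-set-size (λ k → A (suc k)) (Y ─ ⁅ v ⁆) disjoint′ hits′) (x∈p⇒∣p-x∣<∣p∣ v∈Y)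
  where
  disjoint′ : ∀ k l → k ≢ l → ¬ Meets (A (suc k)) (A (suc l))
  disjoint′ k l k≢l = disjoint (suc k) (suc l) (λ { refl → k≢l refl })

  hits′ : ∀ k → Meets (Y ─ ⁅ v ⁆) (A (suc k))
  hits′ k with hits (suc k)
  ... | w , w∈Y , w∈Aₖ = w , x∈p∧x≢y⇒x∈p-y w∈Y (λ { refl → disjoint zero (suc k) (λ ()) (w , v∈A₀ , w∈Aₖ) }) , w∈Aₖ

⊆⋃-tabulate : ∀ {n t} (A : Fin t → Subset n) k → A k ⊆ ⋃ (tabulate A)
⊆⋃-tabulate A zero    = p⊆p∪q _
⊆⋃-tabulate A (suc k) = q⊆p∪q (A zero) _ ∘′ ⊆⋃-tabulate (λ k → A (suc k)) k

∣⋃-tabulate∣≤ : ∀ {n} t (A : Fin t → Subset n) {c} → (∀ k → ∣ A k ∣ ℕ.≤ c) →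
                ∣ ⋃ (tabulate A) ∣ ℕ.≤ t ℕ.* c
∣⋃-tabulate∣≤ {n} zero    A bound = ℕ.≤-reflexive (∣⊥∣≡0 n)
∣⋃-tabulate∣≤     (suc t) A bound =
  ℕ.≤-trans (∣p∪q∣≤∣p∣+∣q∣ (A zero) _) (ℕ.+-mono-≤ (bound zero) (∣⋃-tabulate∣≤ t (λ k → A (suc k)) (λ k → bound (suc k))))

no-three-distinct-Bools : (x y z : Bool) → x ≢ y → x ≢ z → y ≢ z → ⊥
no-three-distinct-Bools false false _     x≢y _   _   = x≢y refl
no-three-distinct-Bools true  true  _     x≢y _   _   = x≢y refl
no-three-distinct-Bools false true  false _   x≢z _   = x≢z refl
no-three-distinct-Bools false true  true  _   _   y≢z = y≢z refl
no-three-distinct-Bools true  false true  _   x≢z _   = x≢z refl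
no-three-distinct-Bools true  false false _   _   y≢z = y≢z refl

t₁∈verts : ∀ {n} (T : Triangle n) → t₁ T ∈ verts T
t₁∈verts T = x∈p∪q⁺ (inj₁ (x∈⁅x⁆ (t₁ T)))

t₂∈verts : ∀ {n} (T : Triangle n) → t₂ T ∈ verts T
t₂∈verts T = x∈p∪q⁺ (inj₂ (x∈p∪q⁺ (inj₁ (x∈⁅x⁆ (t₂ T)))))

t₃∈verts : ∀ {n} (T : Triangle n) → t₃ T ∈ verts T
t₃∈verts T = x∈p∪q⁺ (inj₂ (x∈p∪q⁺ (inj₂ (x∈⁅x⁆ (t₃ T)))))

∣verts∣≤3 : ∀ {n} (T : Triangle n) → ∣ verts T ∣ ℕ.≤ 3
∣verts∣≤3 (tri a b c) =
  ℕ.≤-trans (∣p∪q∣≤∣p∣+∣q∣ ⁅ a ⁆ _)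
    (ℕ.+-mono-≤ (ℕ.≤-reflexive (∣⁅x⁆∣≡1 a))
      (ℕ.≤-trans (∣p∪q∣≤∣p∣+∣q∣ ⁅ b ⁆ _) (ℕ.≤-reflexive (cong₂ ℕ._+_ (∣⁅x⁆∣≡1 b) (∣⁅x⁆∣≡1 c)))))

∣packingVertices∣≤t*3 : ∀ {n t} (𝒯 : Fin t → Triangle n) → ∣ packingVertices 𝒯 ∣ ℕ.≤ t ℕ.* 3
∣packingVertices∣≤t*3 {t = t} 𝒯 = ∣⋃-tabulate∣≤ t (verts ∘′ 𝒯) (λ k → ∣verts∣≤3 (𝒯 k))

-- A triangle avoiding X would be properly 2-coloured by the colouring of G − X.
OCT-meets-triangle : ∀ {n} {D : Fin n → Disk} {X : Subset n} → IsOCTIn D ⊤ X →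
                     ∀ {T} → IsTriangle D T → Meets X (verts T)
OCT-meets-triangle {X = X} (_ , colour , proper) {T} (a~b , a~c , b~c) with nonempty? (X ∩ verts T)
... | yes (v , v∈X∩T) = v , x∈p∩q⁻ X (verts T) v∈X∩T
... | no missed = ⊥-elim (no-three-distinct-Bools (colour a) (colour b) (colour c)
                    (proper a b ∈⊤ ∈⊤ (avoids (t₁∈verts T)) (avoids (t₂∈verts T)) a~b)
                    (proper a c ∈⊤ ∈⊤ (avoids (t₁∈verts T)) (avoids (t₃∈verts T)) a~c)
                    (proper b c ∈⊤ ∈⊤ (avoids (t₂∈verts T)) (avoids (t₃∈verts T)) b~c))
  where
  a = t₁ T
  b = t₂ T
  c = t₃ T
  avoids : ∀ {v} → v ∈ verts T → v ∉ X
  avoids v∈T v∈X = missed (_ , x∈p∩q⁺ (v∈X , v∈T))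

IsOCTIn-restrict : ∀ {n} {D : Fin n → Disk} {U V X : Subset n} → V ⊆ U →
                   IsOCTIn D U X → IsOCTIn D V (X ∩ V)
IsOCTIn-restrict {V = V} {X} V⊆U (_ , colour , proper) =
  (λ v∈X∩V → proj₂ (x∈p∩q⁻ X V v∈X∩V)) ,
  colour ,
  λ i j i∈V j∈V i∉X∩V j∉X∩V → proper i j (V⊆U i∈V) (V⊆U j∈V)
                                 (λ i∈X → i∉X∩V (x∈p∩q⁺ (i∈X , i∈V)))
                                 (λ j∈X → j∉X∩V (x∈p∩q⁺ (j∈X , j∈V)))

packing+residualOCT≤OCT :
  ∀ {n} {D : Fin n → Disk} {opt t m} {𝒯 : Fin t → Triangle n} →
  IsMinOCTSizeIn D ⊤ opt → IsMaximalTrianglePacking D 𝒯 →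
  IsMinOCTSizeIn D (compl (packingVertices 𝒯)) m → t ℕ.+ m ℕ.≤ opt
packing+residualOCT≤OCT {D = D} {opt} {t} {m} {𝒯} ((X , X-OCT , ∣X∣≡opt) , _) (triangles , disjoint , _) (_ , minimal) =
  begin
    t ℕ.+ m                          ≤⟨ ℕ.+-mono-≤ packing≤ (minimal (X ∩ ∁ P) (IsOCTIn-restrict {D = D} (λ _ → ∈⊤) X-OCT)) ⟩
    ∣ X ∩ P ∣ ℕ.+ ∣ X ∩ ∁ P ∣        ≡⟨ sym (∣p∣≡∣p∩q∣+∣p∩∁q∣ X P) ⟩
    ∣ X ∣                            ≡⟨ ∣X∣≡opt ⟩
    opt                              ∎
  where
  open ℕ.≤-Reasoning
  P = packingVertices 𝒯
  packing≤ : t ℕ.≤ ∣ X ∩ P ∣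
  packing≤ = hitting-set-size (verts ∘′ 𝒯) (X ∩ P) disjoint λ k →
    let v , v∈X , v∈T = OCT-meets-triangle {D = D} X-OCT (triangles k)
    in v , x∈p∩q⁺ (v∈X , ⊆⋃-tabulate (verts ∘′ 𝒯) k v∈T) , v∈T

toℚ≡mkℚ : ∀ k → toℚ k ≡ mkℚ (+ k) 0 (Coprime.sym (1-coprimeTo k))
toℚ≡mkℚ k = ℚ.normalize-coprime (Coprime.sym (1-coprimeTo k))

toℚ-mono-≤ : ∀ {a b} → a ℕ.≤ b → toℚ a ≤ toℚ b
toℚ-mono-≤ {a} {b} a≤b rewrite toℚ≡mkℚ a | toℚ≡mkℚ b =
  ℚ.*≤* (subst₂ ℤ._≤_ (sym (ℤ.*-identityʳ (+ a))) (sym (ℤ.*-identityʳ (+ b))) (ℤ.+≤+ a≤b))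

toℚ-homo-+ : ∀ a b → toℚ (a ℕ.+ b) ≡ toℚ a + toℚ b
toℚ-homo-+ a b rewrite toℚ≡mkℚ a | toℚ≡mkℚ b =
  ℚ./-cong (trans (ℤ.pos-+ a b) (sym (cong₂ ℤ._+_ (ℤ.*-identityʳ (+ a)) (ℤ.*-identityʳ (+ b))))) refl

toℚ-homo-* : ∀ a b → toℚ (a ℕ.* b) ≡ toℚ a * toℚ b
toℚ-homo-* a b rewrite toℚ≡mkℚ a | toℚ≡mkℚ b = ℚ./-cong (ℤ.pos-* a b) refl

-- Computed in ℚᵘ, where the normalised + t / suc o is the plain fraction mkℚᵘ (+ t) o.
ratio*opt≡t : ∀ t opt (opt>0 : opt ℕ.> 0) → ratio t opt opt>0 * toℚ opt ≡ toℚ t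
ratio*opt≡t t (suc o) opt>0 = ℚ.toℚᵘ-injective (begin-equality
  toℚᵘ (ratio t (suc o) opt>0 * toℚ (suc o))               ≃⟨ ℚ.toℚᵘ-homo-* (ratio t (suc o) opt>0) (toℚ (suc o)) ⟩
  toℚᵘ (ratio t (suc o) opt>0) ℚᵘ.* toℚᵘ (toℚ (suc o))     ≃⟨ ℚᵘ.*-cong (toℚᵘ-fromℚᵘ (ℚᵘ.mkℚᵘ (+ t) o)) (toℚᵘ-fromℚᵘ (ℚᵘ.mkℚᵘ (+ suc o) 0)) ⟩
  ℚᵘ.mkℚᵘ (+ t) o ℚᵘ.* ℚᵘ.mkℚᵘ (+ suc o) 0                ≃⟨ ℚᵘ.*≡* cross ⟩
  ℚᵘ.mkℚᵘ (+ t) 0                                          ≃⟨ ℚᵘ.≃-sym (toℚᵘ-fromℚᵘ (ℚᵘ.mkℚᵘ (+ t) 0)) ⟩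
  toℚᵘ (toℚ t)                                             ∎)
  where
  open ℚᵘ.≤-Reasoning
  cross : (+ t ℤ.* + suc o) ℤ.* + 1 ≡ + t ℤ.* + (suc o ℕ.* 1)
  cross = trans (ℤ.*-identityʳ _) (cong (λ d → + t ℤ.* + d) (sym (ℕ.*-identityʳ (suc o))))

ratio-bound : ∀ {s x ρ m t o a c : ℚ} → 0ℚ ≤ ρ → s ≤ t * c + x → x ≤ ρ * m → t + m ≤ o → a * o ≡ t →
              s ≤ (c * a + ρ * (1ℚ - a)) * o
ratio-bound {s} {x} {ρ} {m} {t} {o} {a} {c} 0≤ρ s≤ x≤ρm t+m≤o ao≡t = begin
  s                          ≤⟨ s≤ ⟩
  t * c + x                  ≤⟨ ℚ.+-monoʳ-≤ (t * c) x≤ρm ⟩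
  t * c + ρ * m              ≤⟨ ℚ.+-monoʳ-≤ (t * c) (ℚ.*-monoˡ-≤-nonNeg ρ {{ℚ.nonNegative 0≤ρ}} m≤o-t) ⟩
  t * c + ρ * (o - t)        ≡⟨ cong (λ u → u * c + ρ * (o - u)) (sym ao≡t) ⟩
  (a * o) * c + ρ * (o - a * o)
    ≡⟨ solve 4 (λ a o c ρ → (a :* o) :* c :+ ρ :* (o :- a :* o) := (c :* a :+ ρ :* (con 1ℚ :- a)) :* o) refl a o c ρ ⟩
  (c * a + ρ * (1ℚ - a)) * o ∎
  where
  open ℚ.≤-Reasoning
  open +-*-Solver
  m≤o-t : m ≤ o - t
  m≤o-t = begin
    m               ≡⟨ solve 2 (λ t m → m := (t :+ m) :- t) refl t m ⟩
    (t + m) - t     ≤⟨ ℚ.+-monoˡ-≤ (ℚ.- t) t+m≤o ⟩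
    o - t           ∎

lemma4 : {n : ℕ} (D : Fin n → Disk) → ValidDisks D → K4Free D →
         (opt : ℕ) (opt≥1 : opt ≥ 1) → IsMinOCTSizeIn D ⊤ opt →
         {t : ℕ} (𝒯 : Fin t → Triangle n) → IsMaximalTrianglePacking D 𝒯 →
         (ρ₀ : ℚ) → 1ℚ ≤ ρ₀ →
         (m : ℕ) → IsMinOCTSizeIn D (compl (packingVertices 𝒯)) m →
         (X₁ : Subset n) → IsOCTIn D (compl (packingVertices 𝒯)) X₁ →
         toℚ ∣ X₁ ∣ ≤ ρ₀ * toℚ m →
         toℚ ∣ packingVertices 𝒯 ∪ X₁ ∣
           ≤ ((toℚ 3 * ratio t opt opt≥1) + ρ₀ * (1ℚ - ratio t opt opt≥1)) * toℚ opt
lemma4 D _ _ opt opt≥1 minOCT {t} 𝒯 packing ρ₀ 1≤ρ₀ m minResidual X₁ _ ∣X₁∣≤ρ₀m =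
  ratio-bound {a = ratio t opt opt≥1} {c = toℚ 3}
    (ℚ.≤-trans (ℚ.nonNegative⁻¹ 1ℚ) 1≤ρ₀) ∣S₁∣≤ ∣X₁∣≤ρ₀m t+m≤opt (ratio*opt≡t t opt opt≥1)
  where
  open ℚ.≤-Reasoning
  P = packingVertices 𝒯
  ∣S₁∣≤ : toℚ ∣ P ∪ X₁ ∣ ≤ toℚ t * toℚ 3 + toℚ ∣ X₁ ∣
  ∣S₁∣≤ = begin
    toℚ ∣ P ∪ X₁ ∣                  ≤⟨ toℚ-mono-≤ (ℕ.≤-trans (∣p∪q∣≤∣p∣+∣q∣ P X₁) (ℕ.+-monoˡ-≤ ∣ X₁ ∣ (∣packingVertices∣≤t*3 𝒯))) ⟩
    toℚ (t ℕ.* 3 ℕ.+ ∣ X₁ ∣)        ≡⟨ trans (toℚ-homo-+ (t ℕ.* 3) ∣ X₁ ∣) (cong (_+ toℚ ∣ X₁ ∣) (toℚ-homo-* t 3)) ⟩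
    toℚ t * toℚ 3 + toℚ ∣ X₁ ∣      ∎
  t+m≤opt : toℚ t + toℚ m ≤ toℚ opt
  t+m≤opt = begin
    toℚ t + toℚ m      ≡⟨ toℚ-homo-+ t m ⟨
    toℚ (t ℕ.+ m)      ≤⟨ toℚ-mono-≤ (packing+residualOCT≤OCT {D = D} minOCT packing minResidual) ⟩
    toℚ opt            ∎
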